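{- Let $u\equiv 0\pmod{12}$. Then the graph $\langle \mathbb Z_u\cup\{\infty_1,\infty_2,\infty_3\},\{1,2,\frac u2\}\rangle$ can be decomposed into $3$-suns.
   Context: A $3$-sun is the graph on six vertices $a,b,c,d,e,f$ with edges $\{a,b\},\{b,c\},\{c,a\},\{a,d\},\{b,e\},\{c,f\}$; a decomposition of a graph into $3$-suns is a partition of its edge set into subgraphs isomorphic to a $3$-sun. For a positive integer $u$, $\mathbb Z_u=\{0,1,\dots,u-1\}$ (integers mod $u$), and for distinct $i,j\in\mathbb Z_u$, $|i-j|_u=\min\{|i-j|,u-|i-j|\}$. For a set $H$ disjoint from $\mathbb Z_u$ and a nonempty set $D\subseteq\{1,\dots,\lfloor u/2\rfloor\}$, $\langle \mathbb Z_u\cup H,D\rangle$ is the graph with vertex set $\mathbb Z_u\cup H$ and edge set $\{\{i,j\}: i,j\in\mathbb Z_u,\ |i-j|_u\in D\}\cup\{\{\infty,i\}:\infty\in H,\ i\in\mathbb Z_u\}$. -}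

module Defs where

open import Data.Nat using (ℕ; _∸_; _/_; ∣_-_∣; _⊓_)
open import Data.Fin using (Fin; toℕ)
open import Data.Fin.Properties using () renaming (_≟_ to _≟F_)
open import Data.Sum using (_⊎_; inj₁; inj₂)
open import Data.Sum.Properties using (≡-dec)
open import Data.Product using (_×_; _,_)
open import Data.Empty using (⊥)
open import Data.Unit using (⊤)
open import Data.List using (List; []; _∷_; length; filter; concatMap)
open import Data.List.Relation.Unary.All using (All)
open import Relation.Binary.PropositionalEquality using (_≡_; _≢_)
open import Relation.Binary.Definitions using (DecidableEquality)
open import Relation.Nullary using (Dec; ¬_)
open import Relation.Nullary.Decidable using (_⊎-dec_; _×-dec_)
open import Function.Definitions using (Injective)

-- Vertex set Z_u ∪ {∞₁, ∞₂, ∞₃}: inj₁ i is i ∈ Z_u, inj₂ h is ∞_{h+1}.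
Vertex : ℕ → Set
Vertex u = Fin u ⊎ Fin 3

_≟V_ : ∀ {u} → DecidableEquality (Vertex u)
_≟V_ = ≡-dec _≟F_ _≟F_

cdist : (u : ℕ) → Fin u → Fin u → ℕ
cdist u i j = ∣ toℕ i - toℕ j ∣ ⊓ (u ∸ ∣ toℕ i - toℕ j ∣)

Adj : (u : ℕ) → Vertex u → Vertex u → Set
Adj u (inj₁ i) (inj₁ j) =
  i ≢ j × (cdist u i j ≡ 1 ⊎ cdist u i j ≡ 2 ⊎ cdist u i j ≡ u / 2)
Adj u (inj₁ i) (inj₂ h) = ⊤
Adj u (inj₂ h) (inj₁ j) = ⊤
Adj u (inj₂ h) (inj₂ k) = ⊥

record Sun (u : ℕ) : Set where
  field
    v        : Fin 6 → Vertex u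
    distinct : Injective _≡_ _≡_ v

sunEdges : ∀ {u} → Sun u → List (Vertex u × Vertex u)
sunEdges s = (a , b) ∷ (b , c) ∷ (c , a) ∷ (a , d) ∷ (b , e) ∷ (c , f) ∷ []
  where
  open Sun s
  a = v Fin.zero
  b = v (Fin.suc Fin.zero)
  c = v (Fin.suc (Fin.suc Fin.zero))
  d = v (Fin.suc (Fin.suc (Fin.suc Fin.zero)))
  e = v (Fin.suc (Fin.suc (Fin.suc (Fin.suc Fin.zero))))
  f = v (Fin.suc (Fin.suc (Fin.suc (Fin.suc (Fin.suc Fin.zero)))))

SameEdge : ∀ {u} → Vertex u → Vertex u → Vertex u × Vertex u → Set
SameEdge x y (p , q) = (p ≡ x × q ≡ y) ⊎ (p ≡ y × q ≡ x)

sameEdge? : ∀ {u} (x y : Vertex u) (e : Vertex u × Vertex u) → Dec (SameEdge x y e)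
sameEdge? x y (p , q) = ((p ≟V x) ×-dec (q ≟V y)) ⊎-dec ((p ≟V y) ×-dec (q ≟V x))

occurrences : ∀ {u} → Vertex u → Vertex u → List (Vertex u × Vertex u) → ℕ
occurrences x y es = length (filter (sameEdge? x y) es)

IsSunDecomposition : (u : ℕ) → List (Sun u) → Set
IsSunDecomposition u S =
  All (λ { (x , y) → Adj u x y }) (concatMap sunEdges S) ×
  (∀ x y → Adj u x y → occurrences x y (concatMap sunEdges S) ≡ 1)

-- Write u = 12k and N = u/2 = 6k, and split Z_u into k blocks: block t has the low half
-- 6t, ..., 6t + 5 and the high half 6t + N, ..., 6t + N + 5. Every edge of the graph is, in exactly
-- one way, the translate by 6t (t < k) of one of 66 edges of block 0: the chords {p, p + 1} and
-- {p, p + 2} from its 12 residues p, the diameters {a, a + N} (a < 6) and its 36 spokes to the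
-- infinite points. Eleven explicit 3-suns on the residues x, N + x (x < 8) and the infinite points
-- use each of these 66 edges exactly once, so their translates by 6t, t < k, decompose the graph
-- (66k edges in 11k suns).

module Submission where

open import Defs
open import Data.Nat.Divisibility using (_∣_; divides)
open import Data.Nat using (ℕ; zero; suc; _+_; _*_; _∸_; _<_; _≤_; _<?_; _≤?_; s≤s; z≤n; _/_; _%_; _⊓_; ∣_-_∣; NonZero)
import Data.Nat as ℕ
open import Data.Nat.Properties
open import Data.Nat.DivMod using (m*n/n≡m; m%n<n; m<n⇒m%n≡m; m≤n⇒[n∸m]%m≡n%m; %-distribˡ-+; m%n%n≡m%n; [m+n]%n≡m%n)
open import Data.Nat.Tactic.RingSolver using (solve-∀)
open import Data.Fin using (Fin; toℕ; fromℕ<; combine; cast)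
import Data.Fin as Fin
open import Data.Fin.Patterns using (0F; 1F; 2F; 3F; 4F; 5F)
open import Data.Fin.Properties using (toℕ-fromℕ<; toℕ-injective; toℕ<n; toℕ-combine; combine-injective; combine-surjective; toℕ-cast; all?)
open import Data.Product using (Σ; _×_; _,_; proj₁; proj₂; swap; ∃-syntax)
import Data.Product as Product
open import Data.Product.Properties using () renaming (≡-dec to ×-≡-dec)
open import Data.Sum using (_⊎_; inj₁; inj₂)
import Data.Sum as Sum
open import Data.Sum.Properties using (inj₁-injective; inj₂-injective) renaming (≡-dec to ⊎-≡-dec)
open import Data.Empty using (⊥-elim)
open import Data.Unit using (⊤)
open import Function using (_∘_; id)
open import Function.Definitions using (Injective)
open import Data.Vec using (Vec; []; _∷_; lookup)
open import Data.List using (List; []; _∷_; length; filter; map; concatMap; allFin; cartesianProduct)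
open import Data.List.Properties using (filter-accept; filter-reject; map-++; concatMap-++)
open import Data.List.Relation.Unary.All using (All; []; _∷_)
import Data.List.Relation.Unary.All as All
import Data.List.Relation.Unary.All.Properties as All
open import Data.List.Relation.Unary.Any using (here; there)
open import Data.List.Relation.Unary.Unique.Propositional using (Unique; []; _∷_)
open import Data.List.Relation.Unary.Unique.Propositional.Properties using (cartesianProduct⁺; allFin⁺)
import Data.List.Relation.Unary.Unique.DecPropositional as UniqueDec
open import Data.List.Membership.Propositional using (_∈_)
open import Data.List.Membership.Propositional.Properties using (∈-cartesianProduct⁺; ∈-allFin)
import Data.List.Membership.DecPropositional as MembershipDec
open import Data.List.Relation.Binary.Pointwise using (Pointwise; []; _∷_)
import Data.List.Relation.Binary.Pointwise as Pointwise
open import Relation.Binary.PropositionalEquality hiding ([_])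
open import Relation.Binary.Definitions using (DecidableEquality; Tri; tri<; tri≈; tri>)
open import Relation.Nullary using (¬_; Dec; yes; no)
open import Relation.Nullary.Decidable using (_⊎-dec_; _×-dec_; ¬?; True; from-yes; toWitness)
open import Relation.Unary using (Decidable)

module _ {A : Set} {P : A → Set} (P? : Decidable P) where

  count : List A → ℕ
  count xs = length (filter P? xs)

  count-∷-yes : ∀ {x} xs → P x → count (x ∷ xs) ≡ suc (count xs)
  count-∷-yes xs px = cong length (filter-accept P? px)

  count-∷-no : ∀ {x} xs → ¬ P x → count (x ∷ xs) ≡ count xs
  count-∷-no xs ¬px = cong length (filter-reject P? ¬px)

count-pointwise : ∀ {A B : Set} {P : A → Set} {Q : B → Set} {R : A → B → Set}
                  (P? : Decidable P) (Q? : Decidable Q) →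
                  (∀ {a b} → R a b → P a → Q b) → (∀ {a b} → R a b → Q b → P a) →
                  ∀ {xs ys} → Pointwise R xs ys → count P? xs ≡ count Q? ys
count-pointwise P? Q? to from [] = refl
count-pointwise P? Q? to from {x ∷ xs} {y ∷ ys} (r ∷ rs) with P? x
... | yes px = trans (cong suc (count-pointwise P? Q? to from rs)) (sym (count-∷-yes Q? ys (to r px)))
... | no ¬px = trans (count-pointwise P? Q? to from rs) (sym (count-∷-no Q? ys (¬px ∘ from r)))

module _ {A : Set} (_≟_ : DecidableEquality A) where

  count-map-unique : ∀ {B : Set} {P : B → Set} (P? : Decidable P) (f : A → B) {a : A} →
                     (∀ x → P (f x) → x ≡ a) → P (f a) → ∀ xs →
                     count P? (map f xs) ≡ count (_≟ a) xs
  count-map-unique P? f unique pa [] = refl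
  count-map-unique P? f {a} unique pa (x ∷ xs) with P? (f x)
  ... | yes pfx = trans (cong suc (count-map-unique P? f unique pa xs))
                        (sym (count-∷-yes (_≟ a) xs (unique x pfx)))
  ... | no ¬pfx = trans (count-map-unique P? f unique pa xs)
                        (sym (count-∷-no (_≟ a) xs λ { refl → ¬pfx pa }))

  count-∉ : ∀ {a} {xs} → All (a ≢_) xs → count (_≟ a) xs ≡ 0
  count-∉ [] = refl
  count-∉ {a} {x ∷ xs} (a≢x ∷ a∉xs) = trans (count-∷-no (_≟ a) xs (a≢x ∘ sym)) (count-∉ a∉xs)

  count-unique-∈ : ∀ {a} {xs} → Unique xs → a ∈ xs → count (_≟ a) xs ≡ 1
  count-unique-∈ {xs = x ∷ xs} (x∉xs ∷ _) (here refl) =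
    trans (count-∷-yes (_≟ x) xs refl) (cong suc (count-∉ x∉xs))
  count-unique-∈ {a} {x ∷ xs} (x∉xs ∷ u) (there a∈xs) =
    trans (count-∷-no (_≟ a) xs λ { refl → All.lookup x∉xs a∈xs refl }) (count-unique-∈ u a∈xs)

all-pointwise : ∀ {A B : Set} {P : A → Set} {Q : B → Set} {R : A → B → Set} →
                (∀ {a b} → R a b → Q b → P a) → ∀ {xs ys} → Pointwise R xs ys → All Q ys → All P xs
all-pointwise from [] [] = []
all-pointwise from (r ∷ rs) (q ∷ qs) = from r q ∷ all-pointwise from rs qs

_~_ : {A : Set} → A × A → A × A → Set
e ~ e′ = e ≡ e′ ⊎ e ≡ swap e′

~-reflexive : ∀ {A : Set} {e e′ : A × A} → e ≡ e′ → e ~ e′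
~-reflexive = inj₁

~-swap : ∀ {A : Set} {e e′ : A × A} → e ≡ swap e′ → e ~ e′
~-swap = inj₂

~-sym : ∀ {A : Set} {e e′ : A × A} → e ~ e′ → e′ ~ e
~-sym (inj₁ refl) = inj₁ refl
~-sym (inj₂ refl) = inj₂ refl

~-trans : ∀ {A : Set} {e e′ e″ : A × A} → e ~ e′ → e′ ~ e″ → e ~ e″
~-trans (inj₁ refl) q = q
~-trans (inj₂ refl) (inj₁ refl) = inj₂ refl
~-trans (inj₂ refl) (inj₂ refl) = inj₁ refl

~-map : ∀ {A B : Set} (f : A → B) {e e′ : A × A} → e ~ e′ → Product.map f f e ~ Product.map f f e′
~-map f (inj₁ refl) = inj₁ refl
~-map f (inj₂ refl) = inj₂ refl

~-dec : ∀ {A : Set} → DecidableEquality A → ∀ (e e′ : A × A) → Dec (e ~ e′)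
~-dec {A} _≟_ e e′ = ≡-dec e e′ ⊎-dec ≡-dec e (swap e′)
  where ≡-dec : DecidableEquality (A × A)
        ≡-dec = ×-≡-dec _≟_ _≟_

~⇒SameEdge : ∀ {u} {x y : Vertex u} {e} → e ~ (x , y) → SameEdge x y e
~⇒SameEdge (inj₁ refl) = inj₁ (refl , refl)
~⇒SameEdge (inj₂ refl) = inj₂ (refl , refl)

SameEdge⇒~ : ∀ {u} {x y : Vertex u} e → SameEdge x y e → e ~ (x , y)
SameEdge⇒~ _ (inj₁ (refl , refl)) = inj₁ refl
SameEdge⇒~ _ (inj₂ (refl , refl)) = inj₂ refl

SameEdge-resp-~ : ∀ {u} {x y : Vertex u} {e e′} → e ~ e′ → SameEdge x y e → SameEdge x y e′
SameEdge-resp-~ {e = e} r s = ~⇒SameEdge (~-trans (~-sym r) (SameEdge⇒~ e s))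

cdist-sym : ∀ u (i j : Fin u) → cdist u i j ≡ cdist u j i
cdist-sym u i j = cong (λ d → d ⊓ (u ∸ d)) (∣-∣-comm (toℕ i) (toℕ j))

Adj-sym : ∀ {u} {x y : Vertex u} → Adj u x y → Adj u y x
Adj-sym {u} {inj₁ i} {inj₁ j} (i≢j , d) =
  i≢j ∘ sym , subst (λ c → c ≡ 1 ⊎ c ≡ 2 ⊎ c ≡ u / 2) (cdist-sym u i j) d
Adj-sym {x = inj₁ _} {inj₂ _} _ = _
Adj-sym {x = inj₂ _} {inj₁ _} _ = _

∸-bound : ∀ {x y b} → y ≤ x + b → y ∸ x ≤ b
∸-bound {x} {y} {b} y≤x+b = subst (y ∸ x ≤_) (m+n∸m≡n x b) (∸-monoˡ-≤ x y≤x+b)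

module Residues (u : ℕ) .{{_ : NonZero u}} where

  [_] : ℕ → Fin u
  [ m ] = fromℕ< (m%n<n m u)

  toℕ-[] : ∀ m → toℕ [ m ] ≡ m % u
  toℕ-[] m = toℕ-fromℕ< (m%n<n m u)

  []-≡ : ∀ m n → m % u ≡ n % u → [ m ] ≡ [ n ]
  []-≡ m n e = toℕ-injective (trans (toℕ-[] m) (trans e (sym (toℕ-[] n))))

  ≡-[] : ∀ m n → [ m ] ≡ [ n ] → m % u ≡ n % u
  ≡-[] m n e = trans (sym (toℕ-[] m)) (trans (cong toℕ e) (toℕ-[] n))

  [toℕ] : ∀ (i : Fin u) → [ toℕ i ] ≡ i
  [toℕ] i = toℕ-injective (trans (toℕ-[] _) (m<n⇒m%n≡m (toℕ<n i)))

  []-injective : ∀ {m n} → m < u → n < u → [ m ] ≡ [ n ] → m ≡ n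
  []-injective {m} {n} m<u n<u e = trans (sym (m<n⇒m%n≡m m<u)) (trans (≡-[] m n e) (m<n⇒m%n≡m n<u))

  [toℕ+] : ∀ m d → [ toℕ [ m ] + d ] ≡ [ m + d ]
  [toℕ+] m d = []-≡ (toℕ [ m ] + d) (m + d) (begin
    (toℕ [ m ] + d) % u      ≡⟨ cong (λ r → (r + d) % u) (toℕ-[] m) ⟩
    (m % u + d) % u          ≡⟨ %-distribˡ-+ (m % u) d u ⟩
    (m % u % u + d % u) % u  ≡⟨ cong (λ r → (r + d % u) % u) (m%n%n≡m%n m u) ⟩
    (m % u + d % u) % u      ≡⟨ sym (%-distribˡ-+ m d u) ⟩
    (m + d) % u              ∎)
    where open ≡-Reasoning

  [+]-cong : ∀ m n d → [ m ] ≡ [ n ] → [ m + d ] ≡ [ n + d ]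
  [+]-cong m n d e = trans (sym ([toℕ+] m d)) (trans (cong (λ i → [ toℕ i + d ]) e) ([toℕ+] n d))

  [+u] : ∀ m → [ m + u ] ≡ [ m ]
  [+u] m = []-≡ (m + u) m ([m+n]%n≡m%n m u)

  %-below-2u : ∀ x → x < u + u → x % u ≡ x ⊎ x % u + u ≡ x
  %-below-2u x x<2u with x <? u
  ... | yes x<u = inj₁ (m<n⇒m%n≡m x<u)
  ... | no x≮u = inj₂ (trans (cong (_+ u) x%u≡x∸u) (m∸n+n≡m u≤x))
    where
    u≤x : u ≤ x
    u≤x = ≮⇒≥ x≮u
    x∸u<u : x ∸ u < u
    x∸u<u = +-cancelʳ-< u (x ∸ u) u (subst (_< u + u) (sym (m∸n+n≡m u≤x)) x<2u)
    x%u≡x∸u : x % u ≡ x ∸ u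
    x%u≡x∸u = trans (sym (m≤n⇒[n∸m]%m≡n%m u≤x)) (m<n⇒m%n≡m x∸u<u)

  %-shift-≢ : ∀ {r d} → r < u → 0 < d → d < u → r ≢ (r + d) % u
  %-shift-≢ {r} {d} r<u 0<d d<u r≡ with %-below-2u (r + d) (+-mono-< r<u d<u)
  ... | inj₁ e = <-irrefl (trans r≡ e) (m<m+n r 0<d)
  ... | inj₂ e = <-irrefl (sym (+-cancelˡ-≡ r u d (trans (cong (_+ u) r≡) e))) d<u

  shift-≢ : ∀ m {d} → 0 < d → d < u → [ m ] ≢ [ m + d ]
  shift-≢ m {d} 0<d d<u e = %-shift-≢ (toℕ<n [ m ]) 0<d d<u
    (trans (sym (m<n⇒m%n≡m (toℕ<n [ m ]))) (≡-[] (toℕ [ m ]) (toℕ [ m ] + d) e′))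
    where e′ : [ toℕ [ m ] ] ≡ [ toℕ [ m ] + d ]
          e′ = trans ([toℕ] [ m ]) (trans e (sym ([toℕ+] m d)))

  [+]-≢ : ∀ m {x y} → x < y → y ∸ x < u → [ m + x ] ≢ [ m + y ]
  [+]-≢ m {x} {y} x<y gap<u e = shift-≢ (m + x) (m<n⇒0<n∸m x<y) gap<u
    (trans e (cong [_] (trans (cong (m +_) (sym (m+[n∸m]≡n (<⇒≤ x<y)))) (sym (+-assoc m x (y ∸ x))))))

  [+]-cancelˡ : ∀ m {d d′} → d < u → d′ < u → [ m + d ] ≡ [ m + d′ ] → d ≡ d′
  [+]-cancelˡ m {d} {d′} d<u d′<u e with <-cmp d d′
  ... | tri< d<d′ _ _ = ⊥-elim ([+]-≢ m d<d′ (≤-<-trans (m∸n≤m d′ d) d′<u) e)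
  ... | tri≈ _ d≡d′ _ = d≡d′
  ... | tri> _ _ d′<d = ⊥-elim ([+]-≢ m d′<d (≤-<-trans (m∸n≤m d d′) d<u) (sym e))

  ∣-∣-shift : ∀ {r δ} → r < u → δ ≤ u → ∣ r - (r + δ) % u ∣ ≡ δ ⊎ ∣ r - (r + δ) % u ∣ ≡ u ∸ δ
  ∣-∣-shift {r} {δ} r<u δ≤u with %-below-2u (r + δ) (+-mono-<-≤ r<u δ≤u)
  ... | inj₁ e = inj₁ (trans (cong (λ s → ∣ r - s ∣) e) (∣m-m+n∣≡n r δ))
  ... | inj₂ e = inj₂ (begin
    ∣ r - s ∣              ≡⟨ sym (∣m+n-m+o∣≡∣n-o∣ δ r s) ⟩
    ∣ δ + r - δ + s ∣      ≡⟨ cong₂ ∣_-_∣ (trans (+-comm δ r) (sym e)) (+-comm δ s) ⟩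
    ∣ s + u - s + δ ∣      ≡⟨ ∣m+n-m+o∣≡∣n-o∣ s u δ ⟩
    ∣ u - δ ∣              ≡⟨ m≤n⇒∣n-m∣≡n∸m δ≤u ⟩
    u ∸ δ                  ∎)
    where open ≡-Reasoning
          s : ℕ
          s = (r + δ) % u

  ⊓-complement : ∀ {D δ} → δ ≤ u ∸ δ → D ≡ δ ⊎ D ≡ u ∸ δ → D ⊓ (u ∸ D) ≡ δ
  ⊓-complement δ≤u∸δ (inj₁ refl) = m≤n⇒m⊓n≡m δ≤u∸δ
  ⊓-complement {δ = δ} δ≤u∸δ (inj₂ refl) =
    trans (cong ((u ∸ δ) ⊓_) (m∸[m∸n]≡n (≤-trans δ≤u∸δ (m∸n≤m u δ)))) (m≥n⇒m⊓n≡n δ≤u∸δ)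

  ⊓-complement⁻ : ∀ {D d} → D ≤ u → D ⊓ (u ∸ D) ≡ d → D ≡ d ⊎ D ≡ u ∸ d
  ⊓-complement⁻ {D} D≤u refl with ⊓-sel D (u ∸ D)
  ... | inj₁ e = inj₁ (sym e)
  ... | inj₂ e = inj₂ (trans (sym (m∸[m∸n]≡n D≤u)) (cong (u ∸_) (sym e)))

  cdist-shift : ∀ (i : Fin u) {δ} → δ ≤ u ∸ δ → cdist u i [ toℕ i + δ ] ≡ δ
  cdist-shift i {δ} δ≤u∸δ = ⊓-complement δ≤u∸δ
    (subst (λ s → ∣ toℕ i - s ∣ ≡ δ ⊎ ∣ toℕ i - s ∣ ≡ u ∸ δ) (sym (toℕ-[] (toℕ i + δ)))
      (∣-∣-shift (toℕ<n i) (≤-trans δ≤u∸δ (m∸n≤m u δ))))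

  gap⇒shift : ∀ {I J d} → I ≤ J → d ≤ u → J ∸ I ≡ d ⊎ J ∸ I ≡ u ∸ d →
              [ I + d ] ≡ [ J ] ⊎ [ J + d ] ≡ [ I ]
  gap⇒shift {I} {J} I≤J d≤u (inj₁ refl) = inj₁ (cong [_] (m+[n∸m]≡n I≤J))
  gap⇒shift {I} {J} {d} I≤J d≤u (inj₂ gap) = inj₂ (trans (cong [_] J+d≡I+u) ([+u] I))
    where
    open ≡-Reasoning
    J+d≡I+u : J + d ≡ I + u
    J+d≡I+u = begin
      J + d              ≡⟨ cong (_+ d) (sym (m+[n∸m]≡n I≤J)) ⟩
      I + (J ∸ I) + d    ≡⟨ cong (λ g → I + g + d) gap ⟩
      I + (u ∸ d) + d    ≡⟨ +-assoc I (u ∸ d) d ⟩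
      I + (u ∸ d + d)    ≡⟨ cong (I +_) (m∸n+n≡m d≤u) ⟩
      I + u              ∎

  cdist-gap : ∀ (i j : Fin u) {d} → toℕ i ≤ toℕ j → cdist u i j ≡ d →
              toℕ j ∸ toℕ i ≡ d ⊎ toℕ j ∸ toℕ i ≡ u ∸ d
  cdist-gap i j i≤j c = subst (λ D → D ≡ _ ⊎ D ≡ _) (m≤n⇒∣m-n∣≡n∸m i≤j) (⊓-complement⁻ ∣i-j∣≤u c)
    where ∣i-j∣≤u : ∣ toℕ i - toℕ j ∣ ≤ u
          ∣i-j∣≤u = ≤-trans (∣m-n∣≤m⊔n (toℕ i) (toℕ j)) (⊔-lub (<⇒≤ (toℕ<n i)) (<⇒≤ (toℕ<n j)))

  cdist⇒shift-≤ : ∀ (i j : Fin u) {d} → toℕ i ≤ toℕ j → d ≤ u → cdist u i j ≡ d →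
                  j ≡ [ toℕ i + d ] ⊎ i ≡ [ toℕ j + d ]
  cdist⇒shift-≤ i j i≤j d≤u c with gap⇒shift i≤j d≤u (cdist-gap i j i≤j c)
  ... | inj₁ e = inj₁ (trans (sym ([toℕ] j)) (sym e))
  ... | inj₂ e = inj₂ (trans (sym ([toℕ] i)) (sym e))

  cdist⇒shift : ∀ (i j : Fin u) {d} → d ≤ u → cdist u i j ≡ d →
                j ≡ [ toℕ i + d ] ⊎ i ≡ [ toℕ j + d ]
  cdist⇒shift i j d≤u c with ≤-total (toℕ i) (toℕ j)
  ... | inj₁ i≤j = cdist⇒shift-≤ i j i≤j d≤u c
  ... | inj₂ j≤i = Sum.swap (cdist⇒shift-≤ j i j≤i d≤u (trans (cdist-sym u j i) c))

-- In block t, inj₁ (h , x) is the residue 6t + hN + x (x may reach into the next block)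
-- and inj₂ g is the infinite point ∞_{g+1}.
Offset : Set
Offset = (Fin 2 × ℕ) ⊎ Fin 3

-- The 66 edges of a block, with p = 6t + hN + a: step₁ h a is {p, p + 1}, step₂ h a is {p, p + 2},
-- diameter a is {6t + a, 6t + a + N} and spoke g h a is {∞_{g+1}, p}. A sum of products rather
-- than a data type, so that decidable equality comes from the library.
Chord : Set
Chord = (Fin 2 × Fin 6) ⊎ (Fin 2 × Fin 6) ⊎ Fin 6

pattern step₁ h a = inj₁ (h , a)
pattern step₂ h a = inj₂ (inj₁ (h , a))
pattern diameter a = inj₂ (inj₂ a)

Kind : Set
Kind = Chord ⊎ (Fin 3 × Fin 2 × Fin 6)

pattern chord c = inj₁ c
pattern spoke g h a = inj₂ (g , h , a)

kindOffsets : Kind → Offset × Offset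
kindOffsets (chord (step₁ h a)) = inj₁ (h , toℕ a) , inj₁ (h , toℕ a + 1)
kindOffsets (chord (step₂ h a)) = inj₁ (h , toℕ a) , inj₁ (h , toℕ a + 2)
kindOffsets (chord (diameter a)) = inj₁ (0F , toℕ a) , inj₁ (1F , toℕ a)
kindOffsets (spoke g h a) = inj₂ g , inj₁ (h , toℕ a)

_≟ₒ_ : DecidableEquality Offset
_≟ₒ_ = ⊎-≡-dec (×-≡-dec Fin._≟_ ℕ._≟_) Fin._≟_

_≟ₖ_ : DecidableEquality Kind
_≟ₖ_ = ⊎-≡-dec (⊎-≡-dec fin₂×fin₆ (⊎-≡-dec fin₂×fin₆ Fin._≟_)) (×-≡-dec Fin._≟_ fin₂×fin₆)
  where fin₂×fin₆ : DecidableEquality (Fin 2 × Fin 6)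
        fin₂×fin₆ = ×-≡-dec Fin._≟_ Fin._≟_

open UniqueDec _≟ₖ_ using (unique?)
open MembershipDec _≟ₖ_ using (_∈?_)

Near : ℕ → ℕ → ℕ → Set
Near b x y = x ≤ y + b × y ≤ x + b

near? : ∀ b x y → Dec (Near b x y)
near? b x y = x ≤? y + b ×-dec y ≤? x + b

-- Apart offsets name distinct vertices as soon as u ≥ 12: residues of one half are then at most
-- 11 < u apart, and residues of opposite halves differ by N ± 5, which lies strictly between 0 and u.
Apart : Offset → Offset → Set
Apart (inj₁ _) (inj₂ _) = ⊤
Apart (inj₂ _) (inj₁ _) = ⊤
Apart (inj₂ g) (inj₂ g′) = g ≢ g′
Apart (inj₁ (0F , x)) (inj₁ (0F , y)) = x ≢ y × Near 11 x y
Apart (inj₁ (1F , x)) (inj₁ (1F , y)) = x ≢ y × Near 11 x y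
Apart (inj₁ (0F , x)) (inj₁ (1F , y)) = Near 5 x y
Apart (inj₁ (1F , x)) (inj₁ (0F , y)) = Near 5 x y

apart? : ∀ o o′ → Dec (Apart o o′)
apart? (inj₁ _) (inj₂ _) = yes _
apart? (inj₂ _) (inj₁ _) = yes _
apart? (inj₂ g) (inj₂ g′) = ¬? (g Fin.≟ g′)
apart? (inj₁ (0F , x)) (inj₁ (0F , y)) = ¬? (x ℕ.≟ y) ×-dec near? 11 x y
apart? (inj₁ (1F , x)) (inj₁ (1F , y)) = ¬? (x ℕ.≟ y) ×-dec near? 11 x y
apart? (inj₁ (0F , x)) (inj₁ (1F , y)) = near? 5 x y
apart? (inj₁ (1F , x)) (inj₁ (0F , y)) = near? 5 x y

PairwiseApart : Vec Offset 6 → Set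
PairwiseApart os = ∀ i j → i ≡ j ⊎ Apart (lookup os i) (lookup os j)

pairwiseApart? : ∀ os → Dec (PairwiseApart os)
pairwiseApart? os = all? λ i → all? λ j → i Fin.≟ j ⊎-dec apart? (lookup os i) (lookup os j)

record BaseSun : Set where
  constructor baseSun
  field
    offsets : Vec Offset 6
    {pairwiseApart} : True (pairwiseApart? offsets)

sunOffsetEdges : BaseSun → List (Offset × Offset)
sunOffsetEdges s =
  (o 0F , o 1F) ∷ (o 1F , o 2F) ∷ (o 2F , o 0F) ∷ (o 0F , o 3F) ∷ (o 1F , o 4F) ∷ (o 2F , o 5F) ∷ []
  where o : Fin 6 → Offset
        o = lookup (BaseSun.offsets s)

low high : ℕ → Offset
low x = inj₁ (0F , x)
high x = inj₁ (1F , x)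

∞ : Fin 3 → Offset
∞ = inj₂

baseSuns : List BaseSun
baseSuns =
  baseSun (low 3  ∷ low 5  ∷ ∞ 1F   ∷ low 2  ∷ low 7  ∷ high 3 ∷ []) ∷
  baseSun (low 5  ∷ ∞ 0F   ∷ high 5 ∷ low 6  ∷ high 1 ∷ high 7 ∷ []) ∷
  baseSun (high 3 ∷ high 4 ∷ high 5 ∷ low 3  ∷ ∞ 1F   ∷ high 6 ∷ []) ∷
  baseSun (low 2  ∷ low 4  ∷ ∞ 2F   ∷ ∞ 0F   ∷ low 6  ∷ high 2 ∷ []) ∷
  baseSun (low 4  ∷ ∞ 0F   ∷ high 4 ∷ low 5  ∷ low 3  ∷ high 6 ∷ []) ∷
  baseSun (low 1  ∷ low 3  ∷ ∞ 2F   ∷ ∞ 0F   ∷ low 4  ∷ low 5  ∷ []) ∷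
  baseSun (low 0  ∷ ∞ 2F   ∷ high 0 ∷ ∞ 0F   ∷ high 4 ∷ ∞ 1F   ∷ []) ∷
  baseSun (high 1 ∷ high 3 ∷ ∞ 2F   ∷ ∞ 1F   ∷ high 2 ∷ high 5 ∷ []) ∷
  baseSun (high 0 ∷ high 2 ∷ ∞ 0F   ∷ high 1 ∷ high 4 ∷ high 3 ∷ []) ∷
  baseSun (low 2  ∷ ∞ 1F   ∷ high 2 ∷ low 1  ∷ low 4  ∷ high 1 ∷ []) ∷
  baseSun (low 0  ∷ low 1  ∷ ∞ 1F   ∷ low 2  ∷ high 1 ∷ high 5 ∷ []) ∷
  []

baseKinds : List Kind
baseKinds =
  chord (step₂ 0F 3F) ∷ spoke 1F 0F 5F ∷ spoke 1F 0F 3F ∷ chord (step₁ 0F 2F) ∷ chord (step₂ 0F 5F) ∷ spoke 1F 1F 3F ∷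
  spoke 0F 0F 5F ∷ spoke 0F 1F 5F ∷ chord (diameter 5F) ∷ chord (step₁ 0F 5F) ∷ spoke 0F 1F 1F ∷ chord (step₂ 1F 5F) ∷
  chord (step₁ 1F 3F) ∷ chord (step₁ 1F 4F) ∷ chord (step₂ 1F 3F) ∷ chord (diameter 3F) ∷ spoke 1F 1F 4F ∷ chord (step₁ 1F 5F) ∷
  chord (step₂ 0F 2F) ∷ spoke 2F 0F 4F ∷ spoke 2F 0F 2F ∷ spoke 0F 0F 2F ∷ chord (step₂ 0F 4F) ∷ spoke 2F 1F 2F ∷
  spoke 0F 0F 4F ∷ spoke 0F 1F 4F ∷ chord (diameter 4F) ∷ chord (step₁ 0F 4F) ∷ spoke 0F 0F 3F ∷ chord (step₂ 1F 4F) ∷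
  chord (step₂ 0F 1F) ∷ spoke 2F 0F 3F ∷ spoke 2F 0F 1F ∷ spoke 0F 0F 1F ∷ chord (step₁ 0F 3F) ∷ spoke 2F 0F 5F ∷
  spoke 2F 0F 0F ∷ spoke 2F 1F 0F ∷ chord (diameter 0F) ∷ spoke 0F 0F 0F ∷ spoke 2F 1F 4F ∷ spoke 1F 1F 0F ∷
  chord (step₂ 1F 1F) ∷ spoke 2F 1F 3F ∷ spoke 2F 1F 1F ∷ spoke 1F 1F 1F ∷ chord (step₁ 1F 2F) ∷ spoke 2F 1F 5F ∷
  chord (step₂ 1F 0F) ∷ spoke 0F 1F 2F ∷ spoke 0F 1F 0F ∷ chord (step₁ 1F 0F) ∷ chord (step₂ 1F 2F) ∷ spoke 0F 1F 3F ∷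
  spoke 1F 0F 2F ∷ spoke 1F 1F 2F ∷ chord (diameter 2F) ∷ chord (step₁ 0F 1F) ∷ spoke 1F 0F 4F ∷ chord (step₁ 1F 1F) ∷
  chord (step₁ 0F 0F) ∷ spoke 1F 0F 1F ∷ spoke 1F 0F 0F ∷ chord (step₂ 0F 0F) ∷ chord (diameter 1F) ∷ spoke 1F 1F 5F ∷
  []

baseKinds-match : Pointwise _~_ (concatMap sunOffsetEdges baseSuns) (map kindOffsets baseKinds)
baseKinds-match =
  from-yes (Pointwise.decidable (~-dec _≟ₒ_) (concatMap sunOffsetEdges baseSuns) (map kindOffsets baseKinds))

baseKinds-unique : Unique baseKinds
baseKinds-unique = from-yes (unique? baseKinds)

baseKinds-complete : ∀ κ → κ ∈ baseKinds
baseKinds-complete (chord (step₁ h a)) = from-yes (all? λ h → all? λ a → chord (step₁ h a) ∈? baseKinds) h a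
baseKinds-complete (chord (step₂ h a)) = from-yes (all? λ h → all? λ a → chord (step₂ h a) ∈? baseKinds) h a
baseKinds-complete (chord (diameter a)) = from-yes (all? λ a → chord (diameter a) ∈? baseKinds) a
baseKinds-complete (spoke g h a) = from-yes (all? λ g → all? λ h → all? λ a → spoke g h a ∈? baseKinds) g h a

module Construction (k′ : ℕ) where

  k N u : ℕ
  k = suc k′
  N = k * 6
  u = k * 12

  open Residues u

  u≡N+N : u ≡ N + N
  u≡N+N = lemma k
    where lemma : ∀ x → x * 12 ≡ x * 6 + x * 6
          lemma = solve-∀

  u≡2*N : u ≡ 2 * N
  u≡2*N = lemma k
    where lemma : ∀ x → x * 12 ≡ 2 * (x * 6)
          lemma = solve-∀

  half : Fin 2 → ℕ
  half 0F = 0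
  half 1F = N

  position : Fin k → Fin 2 → ℕ → ℕ
  position t h x = half h + (6 * toℕ t + x)

  position-+ : ∀ t h x d → position t h x + d ≡ position t h (x + d)
  position-+ t h x d = trans (+-assoc (half h) _ d) (cong (half h +_) (+-assoc (6 * toℕ t) x d))

  position-combine : ∀ t h (a : Fin 6) → toℕ (combine h (combine t a)) ≡ position t h (toℕ a)
  position-combine t h a = trans (toℕ-combine h (combine t a)) (cong₂ _+_ (N*h≡half h) (toℕ-combine t a))
    where N*h≡half : ∀ h → N * toℕ h ≡ half h
          N*h≡half 0F = *-zeroʳ N
          N*h≡half 1F = *-identityʳ N

  position<u : ∀ t h (a : Fin 6) → position t h (toℕ a) < u
  position<u t h a = subst₂ _<_ (position-combine t h a) (sym u≡2*N) (toℕ<n (combine h (combine t a)))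

  position-injective : ∀ t t′ h h′ (a a′ : Fin 6) → position t h (toℕ a) ≡ position t′ h′ (toℕ a′) →
                       t ≡ t′ × h ≡ h′ × a ≡ a′
  position-injective t t′ h h′ a a′ e = proj₁ ta≡t′a′ , proj₁ h,ta≡h′,t′a′ , proj₂ ta≡t′a′
    where
    h,ta≡h′,t′a′ : h ≡ h′ × combine t a ≡ combine t′ a′
    h,ta≡h′,t′a′ = combine-injective h (combine t a) h′ (combine t′ a′)
      (toℕ-injective (trans (position-combine t h a) (trans e (sym (position-combine t′ h′ a′)))))
    ta≡t′a′ : t ≡ t′ × a ≡ a′
    ta≡t′a′ = combine-injective t a t′ a′ (proj₂ h,ta≡h′,t′a′)

  position-surjective : ∀ (i : Fin u) → ∃[ t ] ∃[ h ] ∃[ a ] [ position t h (toℕ a) ] ≡ i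
  position-surjective i with combine-surjective (cast u≡2*N i)
  ... | h , j , hj≡i with combine-surjective j
  ... | t , a , ta≡j = t , h , a , trans (cong [_] position≡i) ([toℕ] i)
    where position≡i : position t h (toℕ a) ≡ toℕ i
          position≡i = begin
            position t h (toℕ a)           ≡⟨ sym (position-combine t h a) ⟩
            toℕ (combine h (combine t a))  ≡⟨ cong (λ j → toℕ (combine h j)) ta≡j ⟩
            toℕ (combine h j)              ≡⟨ cong toℕ hj≡i ⟩
            toℕ (cast u≡2*N i)             ≡⟨ toℕ-cast u≡2*N i ⟩
            toℕ i                          ∎
            where open ≡-Reasoning

  Code : Set
  Code = Fin k × Kind

  V : ℕ → Vertex u
  V p = inj₁ [ p ]

  vertexAt : Fin k → Offset → Vertex u
  vertexAt t (inj₁ (h , x)) = V (position t h x)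
  vertexAt t (inj₂ g) = inj₂ g

  codeEdge : Code → Vertex u × Vertex u
  codeEdge (t , κ) = Product.map (vertexAt t) (vertexAt t) (kindOffsets κ)

  shiftEdge : ℕ → ℕ → Vertex u × Vertex u
  shiftEdge p δ = V p , V (p + δ)

  chordStart : Fin k → Chord → ℕ
  chordStart t (step₁ h a) = position t h (toℕ a)
  chordStart t (step₂ h a) = position t h (toℕ a)
  chordStart t (diameter a) = position t 0F (toℕ a)

  chordLength : Chord → ℕ
  chordLength (step₁ _ _) = 1
  chordLength (step₂ _ _) = 2
  chordLength (diameter _) = N

  codeEdge-chord : ∀ t c → codeEdge (t , chord c) ≡ shiftEdge (chordStart t c) (chordLength c)
  codeEdge-chord t (step₁ h a) = cong (λ p → V (position t h (toℕ a)) , V p) (sym (position-+ t h (toℕ a) 1))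
  codeEdge-chord t (step₂ h a) = cong (λ p → V (position t h (toℕ a)) , V p) (sym (position-+ t h (toℕ a) 2))
  codeEdge-chord t (diameter a) = cong (λ p → V (6 * toℕ t + toℕ a) , V p) (+-comm N (6 * toℕ t + toℕ a))

  u∸N≡N : u ∸ N ≡ N
  u∸N≡N = trans (cong (_∸ N) u≡N+N) (m+n∸n≡m N N)

  u/2≡N : u / 2 ≡ N
  u/2≡N = trans (cong (_/ 2) (lemma k)) (m*n/n≡m N 2)
    where lemma : ∀ x → x * 12 ≡ x * 6 * 2
          lemma = solve-∀

  N<u : N < u
  N<u = subst (N <_) (sym u≡N+N) (m<m+n N (s≤s z≤n))

  ChordLength : ℕ → Set
  ChordLength δ = δ ≡ 1 ⊎ δ ≡ 2 ⊎ δ ≡ N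

  ChordLength⇒0< : ∀ {δ} → ChordLength δ → 0 < δ
  ChordLength⇒0< (inj₁ refl) = s≤s z≤n
  ChordLength⇒0< (inj₂ (inj₁ refl)) = s≤s z≤n
  ChordLength⇒0< (inj₂ (inj₂ refl)) = s≤s z≤n

  ChordLength⇒≤N : ∀ {δ} → ChordLength δ → δ ≤ N
  ChordLength⇒≤N (inj₁ refl) = s≤s z≤n
  ChordLength⇒≤N (inj₂ (inj₁ refl)) = s≤s (s≤s z≤n)
  ChordLength⇒≤N (inj₂ (inj₂ refl)) = ≤-refl

  ChordLength⇒<u : ∀ {δ} → ChordLength δ → δ < u
  ChordLength⇒<u ok = ≤-<-trans (ChordLength⇒≤N ok) N<u

  chordLength-ok : ∀ c → ChordLength (chordLength c)
  chordLength-ok (step₁ _ _) = inj₁ refl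
  chordLength-ok (step₂ _ _) = inj₂ (inj₁ refl)
  chordLength-ok (diameter _) = inj₂ (inj₂ refl)

  Adjacent : Vertex u × Vertex u → Set
  Adjacent e = Adj u (proj₁ e) (proj₂ e)

  shiftEdge-adjacent : ∀ p {δ} → ChordLength δ → Adjacent (shiftEdge p δ)
  shiftEdge-adjacent p {δ} ok =
    shift-≢ p (ChordLength⇒0< ok) (ChordLength⇒<u ok) , subst ValidLength (sym cdist≡δ) (valid ok)
    where
    ValidLength : ℕ → Set
    ValidLength d = d ≡ 1 ⊎ d ≡ 2 ⊎ d ≡ u / 2
    valid : ∀ {δ} → ChordLength δ → ValidLength δ
    valid (inj₁ e) = inj₁ e
    valid (inj₂ (inj₁ e)) = inj₂ (inj₁ e)
    valid (inj₂ (inj₂ e)) = inj₂ (inj₂ (trans e (sym u/2≡N)))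
    δ≤u∸δ : δ ≤ u ∸ δ
    δ≤u∸δ = ≤-trans (ChordLength⇒≤N ok) (subst (_≤ u ∸ δ) u∸N≡N (∸-monoʳ-≤ u (ChordLength⇒≤N ok)))
    cdist≡δ : cdist u [ p ] [ p + δ ] ≡ δ
    cdist≡δ = trans (cong (cdist u [ p ]) (sym ([toℕ+] p δ))) (cdist-shift [ p ] δ≤u∸δ)

  codeEdge-adjacent : ∀ c → Adjacent (codeEdge c)
  codeEdge-adjacent (t , chord c) =
    subst Adjacent (sym (codeEdge-chord t c)) (shiftEdge-adjacent (chordStart t c) (chordLength-ok c))
  codeEdge-adjacent (t , spoke g h a) = _

  shiftEdge-cong : ∀ p q δ → [ p ] ≡ [ q ] → shiftEdge p δ ≡ shiftEdge q δ
  shiftEdge-cong p q δ e = cong₂ _,_ (cong inj₁ e) (cong inj₁ ([+]-cong p q δ e))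

  diameter-flip : ∀ q → shiftEdge q N ≡ swap (shiftEdge (q + N) N)
  diameter-flip q = cong (_, V (q + N)) (sym (begin
    V (q + N + N)    ≡⟨ cong V (+-assoc q N N) ⟩
    V (q + (N + N))  ≡⟨ cong (λ n → V (q + n)) (sym u≡N+N) ⟩
    V (q + u)        ≡⟨ cong inj₁ ([+u] q) ⟩
    V q              ∎))
    where open ≡-Reasoning

  position-code : ∀ t h (a : Fin 6) {δ} → ChordLength δ → ∃[ c ] codeEdge c ~ shiftEdge (position t h (toℕ a)) δ
  position-code t h a (inj₁ refl) = (t , chord (step₁ h a)) , ~-reflexive (codeEdge-chord t (step₁ h a))
  position-code t h a (inj₂ (inj₁ refl)) = (t , chord (step₂ h a)) , ~-reflexive (codeEdge-chord t (step₂ h a))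
  position-code t 0F a (inj₂ (inj₂ refl)) = (t , chord (diameter a)) , ~-reflexive (codeEdge-chord t (diameter a))
  position-code t 1F a (inj₂ (inj₂ refl)) = (t , chord (diameter a)) ,
    ~-swap (trans (codeEdge-chord t (diameter a))
                  (trans (diameter-flip q) (cong (λ p → swap (shiftEdge p N)) (+-comm q N))))
    where q : ℕ
          q = position t 0F (toℕ a)

  shift-code : ∀ (s : Fin u) {δ} → ChordLength δ → ∃[ c ] codeEdge c ~ shiftEdge (toℕ s) δ
  shift-code s {δ} ok = via (position-surjective s)
    where
    via : ∃[ t ] ∃[ h ] ∃[ a ] [ position t h (toℕ a) ] ≡ s → ∃[ c ] codeEdge c ~ shiftEdge (toℕ s) δ
    via (t , h , a , e) = Product.map₂ (λ r → ~-trans r (~-reflexive p≡s)) (position-code t h a ok)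
      where p≡s : shiftEdge (position t h (toℕ a)) δ ≡ shiftEdge (toℕ s) δ
            p≡s = shiftEdge-cong (position t h (toℕ a)) (toℕ s) δ (trans e (sym ([toℕ] s)))

  shiftEdge-toℕ : ∀ (i j : Fin u) {δ} → j ≡ [ toℕ i + δ ] → shiftEdge (toℕ i) δ ≡ (inj₁ i , inj₁ j)
  shiftEdge-toℕ i j j≡ = cong₂ _,_ (cong inj₁ ([toℕ] i)) (cong inj₁ (sym j≡))

  chord-code : ∀ (i j : Fin u) {δ} → ChordLength δ → cdist u i j ≡ δ → ∃[ c ] codeEdge c ~ (inj₁ i , inj₁ j)
  chord-code i j {δ} ok d = via (cdist⇒shift i j (<⇒≤ (ChordLength⇒<u ok)) d)
    where
    via : j ≡ [ toℕ i + δ ] ⊎ i ≡ [ toℕ j + δ ] → ∃[ c ] codeEdge c ~ (inj₁ i , inj₁ j)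
    via (inj₁ j≡) = Product.map₂ (λ r → ~-trans r (~-reflexive (shiftEdge-toℕ i j j≡))) (shift-code i ok)
    via (inj₂ i≡) = Product.map₂ (λ r → ~-trans r (~-swap (shiftEdge-toℕ j i i≡))) (shift-code j ok)

  spoke-code : ∀ g (i : Fin u) → ∃[ c ] codeEdge c ≡ (inj₂ g , inj₁ i)
  spoke-code g i = via (position-surjective i)
    where
    via : ∃[ t ] ∃[ h ] ∃[ a ] [ position t h (toℕ a) ] ≡ i → ∃[ c ] codeEdge c ≡ (inj₂ g , inj₁ i)
    via (t , h , a , e) = (t , spoke g h a) , cong (λ j → inj₂ g , inj₁ j) e

  codeEdge-surjective : ∀ x y → Adj u x y → ∃[ c ] codeEdge c ~ (x , y)
  codeEdge-surjective (inj₁ i) (inj₁ j) (_ , inj₁ d) = chord-code i j (inj₁ refl) d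
  codeEdge-surjective (inj₁ i) (inj₁ j) (_ , inj₂ (inj₁ d)) = chord-code i j (inj₂ (inj₁ refl)) d
  codeEdge-surjective (inj₁ i) (inj₁ j) (_ , inj₂ (inj₂ d)) = chord-code i j (inj₂ (inj₂ refl)) (trans d u/2≡N)
  codeEdge-surjective (inj₁ i) (inj₂ g) _ = Product.map₂ ~-swap (spoke-code g i)
  codeEdge-surjective (inj₂ g) (inj₁ i) _ = Product.map₂ ~-reflexive (spoke-code g i)

  chordStart<u : ∀ t c → chordStart t c < u
  chordStart<u t (step₁ h a) = position<u t h a
  chordStart<u t (step₂ h a) = position<u t h a
  chordStart<u t (diameter a) = position<u t 0F a

  diameterStart<N : ∀ t (a : Fin 6) → position t 0F (toℕ a) < N
  diameterStart<N t a = subst (_< N) (toℕ-combine t a) (toℕ<n (combine t a))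

  chord-injective : ∀ (t t′ : Fin k) c c′ → chordStart t c ≡ chordStart t′ c′ → chordLength c ≡ chordLength c′ →
                    t ≡ t′ × c ≡ c′
  chord-injective t t′ (step₁ h a) (step₁ h′ a′) p≡ _ =
    Product.map₂ (λ (h≡ , a≡) → cong₂ (λ h a → step₁ h a) h≡ a≡) (position-injective t t′ h h′ a a′ p≡)
  chord-injective t t′ (step₂ h a) (step₂ h′ a′) p≡ _ =
    Product.map₂ (λ (h≡ , a≡) → cong₂ (λ h a → step₂ h a) h≡ a≡) (position-injective t t′ h h′ a a′ p≡)
  chord-injective t t′ (diameter a) (diameter a′) p≡ _ =
    Product.map₂ (λ (_ , a≡) → cong (λ a → diameter a) a≡) (position-injective t t′ 0F 0F a a′ p≡)
  chord-injective _ _ (step₁ _ _) (step₂ _ _) _ ()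
  chord-injective _ _ (step₁ _ _) (diameter _) _ ()
  chord-injective _ _ (step₂ _ _) (step₁ _ _) _ ()
  chord-injective _ _ (step₂ _ _) (diameter _) _ ()
  chord-injective _ _ (diameter _) (step₁ _ _) _ ()
  chord-injective _ _ (diameter _) (step₂ _ _) _ ()

  shiftEdge-injective : ∀ p p′ δ δ′ → p < u → p′ < u → δ < u → δ′ < u →
                        shiftEdge p δ ≡ shiftEdge p′ δ′ → p ≡ p′ × δ ≡ δ′
  shiftEdge-injective p p′ δ δ′ p<u p′<u δ<u δ′<u e = p≡p′ ,
    [+]-cancelˡ p δ<u δ′<u (trans (inj₁-injective (cong proj₂ e)) (cong (λ q → [ q + δ′ ]) (sym p≡p′)))
    where p≡p′ : p ≡ p′
          p≡p′ = []-injective p<u p′<u (inj₁-injective (cong proj₁ e))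

  shiftEdge-≢-swap : ∀ p p′ δ δ′ → 0 < δ → δ + δ′ < u → shiftEdge p δ ≢ swap (shiftEdge p′ δ′)
  shiftEdge-≢-swap p p′ δ δ′ 0<δ δ+δ′<u e = shift-≢ p (<-≤-trans 0<δ (m≤m+n δ δ′)) δ+δ′<u (sym (begin
    [ p + (δ + δ′) ]  ≡⟨ cong [_] (sym (+-assoc p δ δ′)) ⟩
    [ p + δ + δ′ ]    ≡⟨ [+]-cong (p + δ) p′ δ′ (inj₁-injective (cong proj₂ e)) ⟩
    [ p′ + δ′ ]       ≡⟨ sym (inj₁-injective (cong proj₁ e)) ⟩
    [ p ]             ∎))
    where open ≡-Reasoning

  diameters-≢-swap : ∀ p p′ → p < N → p′ < N → shiftEdge p N ≢ swap (shiftEdge p′ N)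
  diameters-≢-swap p p′ p<N p′<N e = <-irrefl refl (<-≤-trans p<N (subst (N ≤_) (sym p≡p′+N) (m≤n+m N p′)))
    where
    p′+N<u : p′ + N < u
    p′+N<u = subst (p′ + N <_) (sym u≡N+N) (+-monoˡ-< N p′<N)
    p≡p′+N : p ≡ p′ + N
    p≡p′+N = []-injective (<-trans p<N N<u) p′+N<u (inj₁-injective (cong proj₁ e))

  short+chord<u : ∀ {a b} → a ≤ 2 → b ≤ N → a + b < u
  short+chord<u a≤2 b≤N =
    ≤-<-trans (+-mono-≤ a≤2 b≤N) (subst (2 + N <_) (sym u≡N+N) (+-monoˡ-< N {2} {N} (s≤s (s≤s (s≤s z≤n)))))

  chordEdges-≢-swap : ∀ t t′ c c′ →
    shiftEdge (chordStart t c) (chordLength c) ≢ swap (shiftEdge (chordStart t′ c′) (chordLength c′))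
  chordEdges-≢-swap t t′ (diameter a) (diameter a′) =
    diameters-≢-swap (chordStart t (diameter a)) (chordStart t′ (diameter a′))
      (diameterStart<N t a) (diameterStart<N t′ a′)
  chordEdges-≢-swap t t′ c@(step₁ _ _) c′ = shiftEdge-≢-swap (chordStart t c) (chordStart t′ c′) 1 (chordLength c′)
    (s≤s z≤n) (short+chord<u (s≤s z≤n) (ChordLength⇒≤N (chordLength-ok c′)))
  chordEdges-≢-swap t t′ c@(step₂ _ _) c′ = shiftEdge-≢-swap (chordStart t c) (chordStart t′ c′) 2 (chordLength c′)
    (s≤s z≤n) (short+chord<u ≤-refl (ChordLength⇒≤N (chordLength-ok c′)))
  chordEdges-≢-swap t t′ c@(diameter _) c′@(step₁ _ _) = shiftEdge-≢-swap (chordStart t c) (chordStart t′ c′) N 1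
    (s≤s z≤n) (subst (_< u) (+-comm 1 N) (short+chord<u (s≤s z≤n) ≤-refl))
  chordEdges-≢-swap t t′ c@(diameter _) c′@(step₂ _ _) = shiftEdge-≢-swap (chordStart t c) (chordStart t′ c′) N 2
    (s≤s z≤n) (subst (_< u) (+-comm 2 N) (short+chord<u ≤-refl ≤-refl))

  chordEdge-injective : ∀ t t′ c c′ →
    shiftEdge (chordStart t c) (chordLength c) ≡ shiftEdge (chordStart t′ c′) (chordLength c′) → t ≡ t′ × c ≡ c′
  chordEdge-injective t t′ c c′ e = chord-injective t t′ c c′ (proj₁ p≡p′,δ≡δ′) (proj₂ p≡p′,δ≡δ′)
    where
    p≡p′,δ≡δ′ : chordStart t c ≡ chordStart t′ c′ × chordLength c ≡ chordLength c′
    p≡p′,δ≡δ′ = shiftEdge-injective (chordStart t c) (chordStart t′ c′) (chordLength c) (chordLength c′)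
      (chordStart<u t c) (chordStart<u t′ c′) (ChordLength⇒<u (chordLength-ok c)) (ChordLength⇒<u (chordLength-ok c′)) e

  chordEdge≁spoke : ∀ p δ g x → ¬ shiftEdge p δ ~ (inj₂ g , x)
  chordEdge≁spoke p δ g x (inj₁ ())
  chordEdge≁spoke p δ g x (inj₂ ())

  codeEdge-injective : ∀ c c′ → codeEdge c ~ codeEdge c′ → c ≡ c′
  codeEdge-injective (t , chord c) (t′ , chord c′) (inj₁ e) =
    Product.uncurry (cong₂ (λ t c → t , chord c))
      (chordEdge-injective t t′ c c′ (trans (sym (codeEdge-chord t c)) (trans e (codeEdge-chord t′ c′))))
  codeEdge-injective (t , chord c) (t′ , chord c′) (inj₂ e) = ⊥-elim
    (chordEdges-≢-swap t t′ c c′ (trans (sym (codeEdge-chord t c)) (trans e (cong swap (codeEdge-chord t′ c′)))))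
  codeEdge-injective (t , spoke g h a) (t′ , spoke g′ h′ a′) (inj₁ e) = equal (inj₂-injective (cong proj₁ e)) tha≡
    where
    tha≡ : t ≡ t′ × h ≡ h′ × a ≡ a′
    tha≡ = position-injective t t′ h h′ a a′
      ([]-injective (position<u t h a) (position<u t′ h′ a′) (inj₁-injective (cong proj₂ e)))
    equal : g ≡ g′ → t ≡ t′ × h ≡ h′ × a ≡ a′ → (t , spoke g h a) ≡ (t′ , spoke g′ h′ a′)
    equal refl (refl , refl , refl) = refl
  codeEdge-injective (_ , spoke _ _ _) (_ , spoke _ _ _) (inj₂ ())
  codeEdge-injective (t , chord c) (t′ , spoke g h a) r = ⊥-elim (chordEdge≁spoke (chordStart t c) (chordLength c) g
    (V (position t′ h (toℕ a))) (subst (_~ _) (codeEdge-chord t c) r))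
  codeEdge-injective (t , spoke g h a) (t′ , chord c′) r = ⊥-elim (chordEdge≁spoke (chordStart t′ c′) (chordLength c′) g
    (V (position t h (toℕ a))) (subst (_~ _) (codeEdge-chord t′ c′) (~-sym r)))

  11<u : 11 < u
  11<u = m≤m+n 12 (k′ * 12)

  same-half-≢ : ∀ m {x y} → x ≢ y → Near 11 x y → [ m + x ] ≢ [ m + y ]
  same-half-≢ m {x} {y} x≢y (x≤y+11 , y≤x+11) = by-order (<-cmp x y)
    where
    by-order : Tri (x < y) (x ≡ y) (y < x) → [ m + x ] ≢ [ m + y ]
    by-order (tri< x<y _ _) = [+]-≢ m x<y (≤-<-trans (∸-bound y≤x+11) 11<u)
    by-order (tri≈ _ x≡y _) = ⊥-elim (x≢y x≡y)
    by-order (tri> _ _ y<x) = [+]-≢ m y<x (≤-<-trans (∸-bound x≤y+11) 11<u) ∘ sym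

  cross-half-≢ : ∀ m {x y} → Near 5 x y → [ m + x ] ≢ [ m + (N + y) ]
  cross-half-≢ m {x} {y} (x≤y+5 , y≤x+5) = [+]-≢ m x<N+y (≤-<-trans (∸-bound N+y≤x+[N+5]) N+5<u)
    where
    x<N+y : x < N + y
    x<N+y = ≤-<-trans x≤y+5 (subst (y + 5 <_) (+-comm y N) (+-monoʳ-< y (m≤m+n 6 (k′ * 6))))
    N+y≤x+[N+5] : N + y ≤ x + (N + 5)
    N+y≤x+[N+5] = subst (N + y ≤_) (lemma x N) (+-monoʳ-≤ N y≤x+5)
      where lemma : ∀ x N → N + (x + 5) ≡ x + (N + 5)
            lemma = solve-∀
    N+5<u : N + 5 < u
    N+5<u = subst (N + 5 <_) (sym u≡N+N) (+-monoʳ-< N (m≤m+n 6 (k′ * 6)))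

  apart⇒≢ : ∀ t o o′ → Apart o o′ → vertexAt t o ≢ vertexAt t o′
  apart⇒≢ t (inj₁ _) (inj₂ _) _ ()
  apart⇒≢ t (inj₂ _) (inj₁ _) _ ()
  apart⇒≢ t (inj₂ g) (inj₂ g′) g≢g′ = g≢g′ ∘ inj₂-injective
  apart⇒≢ t (inj₁ (0F , x)) (inj₁ (0F , y)) (x≢y , near) = same-half-≢ (6 * toℕ t) x≢y near ∘ inj₁-injective
  apart⇒≢ t (inj₁ (1F , x)) (inj₁ (1F , y)) (x≢y , near) e = same-half-≢ (N + 6 * toℕ t) x≢y near
    (trans (cong [_] (+-assoc N (6 * toℕ t) x))
      (trans (inj₁-injective e) (cong [_] (sym (+-assoc N (6 * toℕ t) y)))))
  apart⇒≢ t (inj₁ (0F , x)) (inj₁ (1F , y)) near e = cross-half-≢ (6 * toℕ t) near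
    (trans (inj₁-injective e) (cong [_] (lemma (6 * toℕ t) N y)))
    where lemma : ∀ m N y → N + (m + y) ≡ m + (N + y)
          lemma = solve-∀
  apart⇒≢ t (inj₁ (1F , x)) (inj₁ (0F , y)) near e = cross-half-≢ (6 * toℕ t) (swap near)
    (trans (inj₁-injective (sym e)) (cong [_] (lemma (6 * toℕ t) N x)))
    where lemma : ∀ m N y → N + (m + y) ≡ m + (N + y)
          lemma = solve-∀

  translate : Fin k → BaseSun → Sun u
  translate t s = record { v = vertexAt t ∘ lookup os ; distinct = injective }
    where
    os : Vec Offset 6
    os = BaseSun.offsets s
    injective : Injective _≡_ _≡_ (vertexAt t ∘ lookup os)
    injective {i} {j} e = Sum.[ id , (λ apart → ⊥-elim (apart⇒≢ t (lookup os i) (lookup os j) apart e)) ]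
      (toWitness (BaseSun.pairwiseApart s) i j)

  blockSuns : Fin k → List (Sun u)
  blockSuns t = map (translate t) baseSuns

  block-match : ∀ t → Pointwise _~_ (concatMap sunEdges (blockSuns t)) (map codeEdge (map (t ,_) baseKinds))
  block-match t = Pointwise.map⁺ vertexPair vertexPair (Pointwise.map (~-map (vertexAt t)) baseKinds-match)
    where vertexPair : Offset × Offset → Vertex u × Vertex u
          vertexPair = Product.map (vertexAt t) (vertexAt t)

  suns : List (Sun u)
  suns = concatMap blockSuns (allFin k)

  codes : List Code
  codes = cartesianProduct (allFin k) baseKinds

  blocks-match : ∀ ts →
    Pointwise _~_ (concatMap sunEdges (concatMap blockSuns ts)) (map codeEdge (cartesianProduct ts baseKinds))
  blocks-match [] = []
  blocks-match (t ∷ ts) = subst₂ (Pointwise _~_)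
    (sym (concatMap-++ sunEdges (blockSuns t) (concatMap blockSuns ts)))
    (sym (map-++ codeEdge (map (t ,_) baseKinds) (cartesianProduct ts baseKinds)))
    (Pointwise.++⁺ (block-match t) (blocks-match ts))

  _≟c_ : DecidableEquality Code
  _≟c_ = ×-≡-dec Fin._≟_ _≟ₖ_

  codes-unique : Unique codes
  codes-unique = cartesianProduct⁺ (allFin⁺ k) baseKinds-unique

  codes-complete : ∀ c → c ∈ codes
  codes-complete (t , κ) = ∈-cartesianProduct⁺ (∈-allFin t) (baseKinds-complete κ)

  Adjacent-resp-~ : ∀ {e e′} → e ~ e′ → Adjacent e′ → Adjacent e
  Adjacent-resp-~ (inj₁ refl) adj = adj
  Adjacent-resp-~ (inj₂ refl) adj = Adj-sym adj

  edges-match : Pointwise _~_ (concatMap sunEdges suns) (map codeEdge codes)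
  edges-match = blocks-match (allFin k)

  edges-adjacent : All Adjacent (concatMap sunEdges suns)
  edges-adjacent = all-pointwise Adjacent-resp-~ edges-match
    (All.map⁺ (All.universal codeEdge-adjacent codes))

  edge-occurs-once : ∀ x y → Adj u x y → occurrences x y (concatMap sunEdges suns) ≡ 1
  edge-occurs-once x y adj = begin
    count (sameEdge? x y) (concatMap sunEdges suns)  ≡⟨ count-pointwise (sameEdge? x y) (sameEdge? x y)
                                                          SameEdge-resp-~ (SameEdge-resp-~ ∘ ~-sym) edges-match ⟩
    count (sameEdge? x y) (map codeEdge codes)       ≡⟨ count-map-unique _≟c_ (sameEdge? x y) codeEdge
                                                          only-code (~⇒SameEdge (proj₂ code)) codes ⟩
    count (_≟c proj₁ code) codes                     ≡⟨ count-unique-∈ _≟c_ codes-unique (codes-complete (proj₁ code)) ⟩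
    1                                                ∎
    where
    open ≡-Reasoning
    code : ∃[ c ] codeEdge c ~ (x , y)
    code = codeEdge-surjective x y adj
    only-code : ∀ c → SameEdge x y (codeEdge c) → c ≡ proj₁ code
    only-code c s = codeEdge-injective c (proj₁ code) (~-trans (SameEdge⇒~ (codeEdge c) s) (~-sym (proj₂ code)))

  isDecomposition : IsSunDecomposition u suns
  isDecomposition = edges-adjacent , edge-occurs-once

lemma2p9 : (u : ℕ) → 0 < u → 12 ∣ u →
    Σ (List (Sun u)) (λ S → IsSunDecomposition u S)
lemma2p9 .(zero * 12) () (divides zero refl)
lemma2p9 .(suc k′ * 12) _ (divides (suc k′) refl) = Construction.suns k′ , Construction.isDecomposition k′
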